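{- Let $k,n$ be positive integers, let $T$ be an antidirected caterpillar with $k$ arcs (with a fixed spine and final vertex), and let $D$ be a convex digraph of order $n$. Then $D$ contains at least $a(D)-(k-1)n$ arcs that are good for $T$.
   Context: A digraph is finite, without loops or parallel arcs, but may contain both $xy$ and $yx$; $a(D)$ is its number of arcs. A convex digraph is a digraph drawn in the plane with its vertices on the unit circle and arcs as straight segments. For vertices $x,y$ of a convex digraph, $V^{x,y}_{\leftarrow x}$ denotes the set of vertices lying (strictly) after $x$ and before $y$ when going clockwise around the circle, and $V^{x,y}_{x\rightarrow}$ denotes $V(D)\setminus(\{x,y\}\cup V^{x,y}_{\leftarrow x})$. A caterpillar is a tree viewed as a path $P$ (its spine), whose two endpoints are leaves of the tree, together with leaves attached to inner vertices of $P$; one endpoint $u$ of $P$ is designated the final vertex, and if $v$ is the neighbour of $u$ then $uv$ is the final edge. An antidirected caterpillar is an orientation of a caterpillar with no directed path of length two. An arc $a$ of $D$ is good for $T$ if there is an embedding $f$ of $T$ in $D$ (an injective map $V(T)\to V(D)$ mapping arcs to arcs) such that, with $x=f(u)$ and $y=f(v)$: the arc of $T$ between $u$ and $v$ is mapped to $a$; if $|V(P)|$ is odd then $V^{x,y}_{\leftarrow x}$ contains no image of a vertex of $T$; and if $|V(P)|$ is even then $V^{x,y}_{x\rightarrow}$ contains no image of a vertex of $T$. -}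

module Defs where

open import Data.Nat using (ℕ; zero; suc; _+_; _*_; _∸_; _≤_; _<_; _%_)
open import Data.Fin using (Fin; toℕ) renaming (zero to fzero; suc to fsuc)
open import Data.Bool using (Bool; true; false; if_then_else_)
open import Data.List using (List; map; allFin; length)
open import Data.Nat.ListAction using (sum)
open import Data.List.Relation.Unary.All using (All)
open import Data.List.Relation.Unary.Unique.Propositional using (Unique)
open import Data.Product using (_×_; _,_; Σ; ∃)
open import Data.Sum using (_⊎_; inj₁; inj₂)
open import Data.Empty using (⊥)
open import Relation.Nullary using (¬_)
open import Relation.Binary.PropositionalEquality using (_≡_)
open import Function.Definitions using (Injective)

-- Convex digraphs.
-- A convex digraph of order n: vertices are Fin n, numbered 0,1,…,n-1
-- in clockwise order around the circle; arcs given by a Boolean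
-- adjacency matrix with no loops.

record ConvexDigraph (n : ℕ) : Set where
  field
    adj   : Fin n → Fin n → Bool
    loopless : ∀ i → adj i i ≡ false
open ConvexDigraph public

Arc : ∀ {n} → ConvexDigraph n → Fin n → Fin n → Set
Arc D x y = adj D x y ≡ true

numArcs : ∀ {n} → ConvexDigraph n → ℕ
numArcs {n} D =
  sum (map (λ i → sum (map (λ j → if adj D i j then 1 else 0) (allFin n))) (allFin n))

-- z ∈ V^{x,y}_{←x}: z lies strictly after x and strictly before y going
-- clockwise (i.e. in increasing index order, cyclically) from x.
Between : ∀ {n} → Fin n → Fin n → Fin n → Set
Between x y z =
    (toℕ x < toℕ z × toℕ z < toℕ y)
  ⊎ (toℕ y < toℕ x × toℕ x < toℕ z)
  ⊎ (toℕ y < toℕ x × toℕ z < toℕ y)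

Outside : ∀ {n} → Fin n → Fin n → Fin n → Set
Outside x y z = ¬ (z ≡ x) × ¬ (z ≡ y) × ¬ Between x y z

-- Spine P has p = 2 + q vertices, spine vertex i adjacent to i+1.
-- The final vertex u is spine vertex 0, its neighbour v is spine vertex 1.
-- There are ℓ further leaves, leaf l attached to the inner spine vertex
-- att l (index in 1 … q = p-2).
-- Orientation: sdir i = true means the spine edge {i,i+1} is oriented
-- i → i+1 (value at the last spine vertex is irrelevant);
-- ldir l = true means the leaf edge is oriented att l → leaf l.

record OrientedCaterpillar : Set where
  field
    q     : ℕ
    ℓ     : ℕ
    att   : Fin ℓ → Fin (2 + q)
    inner : ∀ l → 1 ≤ toℕ (att l) × toℕ (att l) ≤ q
    sdir  : Fin (2 + q) → Bool
    ldir  : Fin ℓ → Bool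
open OrientedCaterpillar public

spineSize : OrientedCaterpillar → ℕ
spineSize T = 2 + q T

Vtx : OrientedCaterpillar → Set
Vtx T = Fin (2 + q T) ⊎ Fin (ℓ T)

data TArc (T : OrientedCaterpillar) : Vtx T → Vtx T → Set where
  spineF : (i j : Fin (2 + q T)) → toℕ j ≡ suc (toℕ i) → sdir T i ≡ true →
           TArc T (inj₁ i) (inj₁ j)
  spineB : (i j : Fin (2 + q T)) → toℕ j ≡ suc (toℕ i) → sdir T i ≡ false →
           TArc T (inj₁ j) (inj₁ i)
  leafF  : (l : Fin (ℓ T)) → ldir T l ≡ true → TArc T (inj₁ (att T l)) (inj₂ l)
  leafB  : (l : Fin (ℓ T)) → ldir T l ≡ false → TArc T (inj₂ l) (inj₁ (att T l))

-- number of arcs of T: (p - 1) spine edges plus ℓ leaf edges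
numTArcs : OrientedCaterpillar → ℕ
numTArcs T = suc (q T) + ℓ T

Antidirected : OrientedCaterpillar → Set
Antidirected T = ∀ a b c → TArc T a b → TArc T b c → ⊥

finalU finalV : (T : OrientedCaterpillar) → Vtx T
finalU T = inj₁ fzero
finalV T = inj₁ (fsuc fzero)

record Embedding (T : OrientedCaterpillar) {n} (D : ConvexDigraph n) : Set where
  field
    f      : Vtx T → Fin n
    inj    : Injective _≡_ _≡_ f
    arcs   : ∀ a b → TArc T a b → Arc D (f a) (f b)
open Embedding public

Good : (T : OrientedCaterpillar) → ∀ {n} (D : ConvexDigraph n) → Fin n × Fin n → Set
Good T {n} D (s , t) =
  Arc D s t ×
  Σ (Embedding T D) λ e →
    let x = f e (finalU T)
        y = f e (finalV T)
    in ((TArc T (finalU T) (finalV T) × x ≡ s × y ≡ t)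
        ⊎ (TArc T (finalV T) (finalU T) × y ≡ s × x ≡ t))
     × (spineSize T % 2 ≡ 1 → ∀ w → ¬ Between x y (f e w))
     × (spineSize T % 2 ≡ 0 → ∀ w → ¬ Outside x y (f e w))

module Submission where

open import Defs
open import Data.Bool using (Bool; true; false; not; _∧_; _∨_; if_then_else_; T?)
open import Data.Bool.Properties using (not-involutive; ∧-assoc; ∧-zeroʳ; T-≡)
open import Data.Empty using (⊥-elim)
open import Data.Fin using (Fin; toℕ; fromℕ<; inject≤) renaming (zero to fzero; suc to fsuc; _≟_ to _≟ᶠ_)
open import Data.Fin.Permutation using (Permutation; permutation)
open import Data.Fin.Properties using (toℕ-injective; toℕ<n; toℕ-fromℕ<; toℕ-fromℕ; toℕ-inject₁; inject≤-injective) renaming (≤∧≢⇒< to ≤∧≢⇒<ᶠ)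
open import Data.List using (List; []; _∷_; _++_; map; allFin; length; lookup; filterᵇ; cartesianProduct; tabulate)
open import Data.List.Membership.Propositional using (_∈_)
open import Data.List.Membership.Propositional.Properties using (∈-lookup; ∈-filter⁺; ∈-filter⁻; ∈-allFin)
import Data.List.Membership.DecPropositional as DecMembership
import Data.List.Membership.Setoid.Properties as SetoidMembership
open import Data.List.Properties using (map-++; map-∘; map-cong; map-tabulate; length-map)
open import Data.List.Relation.Unary.All as All using (All)
open import Data.List.Relation.Unary.All.Properties using (all-filter) renaming (map⁺ to All-map⁺)
open import Data.List.Relation.Unary.AllPairs using (_∷_)
open import Data.List.Relation.Unary.Any using (index)
open import Data.List.Relation.Unary.Unique.Propositional using (Unique)
import Data.List.Relation.Unary.Unique.Propositional.Properties as Unique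
open import Data.Nat using (ℕ; zero; suc; _+_; _*_; _∸_; _≤_; _<_; z≤n; s≤s; _≤?_; _<?_; _≟_; _%_)
open import Data.Nat.DivMod using (_mod_; m<n⇒m%n≡m; [m+n]%n≡m%n)
open import Data.Nat.ListAction using () renaming (sum to listSum)
open import Data.Nat.ListAction.Properties using (sum-++)
open import Data.Nat.Properties
open import Algebra.Properties.CommutativeMonoid.Sum +-0-commutativeMonoid using (sum-syntax; ∑-distrib-+; ∑-comm; ∑-permute; sum-cong-≗; sum-init-last; sum-replicate-zero)
open import Data.Nat.Tactic.RingSolver using (solve-∀)
open import Data.Product using (_×_; _,_; Σ; ∃-syntax; proj₁; proj₂; swap)
open import Data.Sum using (_⊎_; inj₁; inj₂)
open import Function.Base using (_∘_)
open import Function.Bundles using (Equivalence)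
open import Relation.Binary.Definitions using (DecidableEquality)
open import Relation.Binary.PropositionalEquality
open import Relation.Nullary using (¬_; yes; no; Dec; does; contradiction)
open import Relation.Nullary.Decidable using (⌊_⌋; dec-true; dec-false; isYes≗does; fromWitness)

-- Embed T greedily along its spine, starting from the far end.  An arc (x, y) carrying spine edge j
-- (spine vertex j ↦ x, j + 1 ↦ y) is called extendable if, walking around the circle from y (clockwise
-- or counterclockwise according to the parity of the remaining spine), we meet an extendable arc (y, z)
-- for edge j + 1 before x, followed by at least c more neighbours of y before x, where c is the number
-- of leaves at spine vertex j + 1.  The rest of T is then embedded between y and z in this order and the leaves
-- strictly between z and x, so every image lies between y and x: on the side of xy that the parity
-- condition demands.  For fixed y, a neighbour x fails only if (y, x) is not extendable for edge j + 1,
-- or x is the first vertex for which it is, or one of the c neighbours right after that one; hence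
-- every spine edge and every leaf accounts for at most n failing arcs, at most (k − 1) n in all.

⟦_⟧ : Bool → ℕ
⟦ b ⟧ = if b then 1 else 0

⟦⟧≤1 : ∀ b → ⟦ b ⟧ ≤ 1
⟦⟧≤1 true = s≤s z≤n
⟦⟧≤1 false = z≤n

⟦⟧-split : ∀ a b → ⟦ a ⟧ ≡ ⟦ a ∧ b ⟧ + ⟦ a ∧ not b ⟧
⟦⟧-split true true = refl
⟦⟧-split true false = refl
⟦⟧-split false b = refl

∑-mono-≤ : ∀ {N} {f g : Fin N → ℕ} → (∀ i → f i ≤ g i) → ∑[ i < N ] f i ≤ ∑[ i < N ] g i
∑-mono-≤ {zero} f≤g = z≤n
∑-mono-≤ {suc N} f≤g = +-mono-≤ (f≤g fzero) (∑-mono-≤ (f≤g ∘ fsuc))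

∑-const : ∀ N c → ∑[ i < N ] c ≡ N * c
∑-const zero c = refl
∑-const (suc N) c = cong (c +_) (∑-const N c)

∑-zero : ∀ {N} {f : Fin N → ℕ} → (∀ i → f i ≡ 0) → ∑[ i < N ] f i ≡ 0
∑-zero {N} f≡0 = trans (sum-cong-≗ {N} f≡0) (sum-replicate-zero N)

∑∑-split : ∀ {M N} (a b : Fin M → Fin N → Bool) →
  ∑[ i < M ] ∑[ j < N ] ⟦ a i j ⟧ ≡ ∑[ i < M ] ∑[ j < N ] ⟦ a i j ∧ b i j ⟧ + ∑[ i < M ] ∑[ j < N ] ⟦ a i j ∧ not (b i j) ⟧
∑∑-split {M} {N} a b = trans (sum-cong-≗ {M} row) (∑-distrib-+ {M} _ _)
  where
    row : ∀ i → ∑[ j < N ] ⟦ a i j ⟧ ≡ ∑[ j < N ] ⟦ a i j ∧ b i j ⟧ + ∑[ j < N ] ⟦ a i j ∧ not (b i j) ⟧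
    row i = trans (sum-cong-≗ {N} (λ j → ⟦⟧-split (a i j) (b i j))) (∑-distrib-+ {N} _ _)

listSum-tabulate : ∀ {N} (f : Fin N → ℕ) → listSum (tabulate f) ≡ ∑[ i < N ] f i
listSum-tabulate {zero} f = refl
listSum-tabulate {suc N} f = cong (f fzero +_) (listSum-tabulate (f ∘ fsuc))

listSum-allFin : ∀ {N} (f : Fin N → ℕ) → listSum (map f (allFin N)) ≡ ∑[ i < N ] f i
listSum-allFin {N} f = trans (cong listSum (map-tabulate (λ i → i) f)) (listSum-tabulate f)

listSum-cartesianProduct : ∀ {A B : Set} (f : A × B → ℕ) xs (ys : List B) →
  listSum (map f (cartesianProduct xs ys)) ≡ listSum (map (λ x → listSum (map (λ y → f (x , y)) ys)) xs)
listSum-cartesianProduct f [] ys = refl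
listSum-cartesianProduct f (x ∷ xs) ys = begin
  listSum (map f (map (x ,_) ys ++ cartesianProduct xs ys))
    ≡⟨ cong listSum (map-++ f (map (x ,_) ys) _) ⟩
  listSum (map f (map (x ,_) ys) ++ map f (cartesianProduct xs ys))
    ≡⟨ sum-++ (map f (map (x ,_) ys)) _ ⟩
  listSum (map f (map (x ,_) ys)) + listSum (map f (cartesianProduct xs ys))
    ≡⟨ cong₂ _+_ (cong listSum (sym (map-∘ ys))) (listSum-cartesianProduct f xs ys) ⟩
  listSum (map (λ y → f (x , y)) ys) + listSum (map (λ x → listSum (map (λ y → f (x , y)) ys)) xs) ∎
  where open ≡-Reasoning

length-filterᵇ : ∀ {A : Set} (p : A → Bool) xs → length (filterᵇ p xs) ≡ listSum (map (⟦_⟧ ∘ p) xs)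
length-filterᵇ p [] = refl
length-filterᵇ p (x ∷ xs) with p x
... | true = cong suc (length-filterᵇ p xs)
... | false = length-filterᵇ p xs

length-filterᵇ-allFin : ∀ {N} (p : Fin N → Bool) → length (filterᵇ p (allFin N)) ≡ ∑[ i < N ] ⟦ p i ⟧
length-filterᵇ-allFin {N} p = trans (length-filterᵇ p (allFin N)) (listSum-allFin (⟦_⟧ ∘ p))

listSum-allFin² : ∀ {N} (f : Fin N → Fin N → ℕ) →
  listSum (map (λ s → listSum (map (f s) (allFin N))) (allFin N)) ≡ ∑[ s < N ] ∑[ t < N ] f s t
listSum-allFin² {N} f =
  trans (cong listSum (map-cong (λ s → listSum-allFin (f s)) (allFin N))) (listSum-allFin (λ s → ∑[ t < N ] f s t))

length-filterᵇ-allFin² : ∀ {N} (p : Fin N × Fin N → Bool) →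
  length (filterᵇ p (cartesianProduct (allFin N) (allFin N))) ≡ ∑[ s < N ] ∑[ t < N ] ⟦ p (s , t) ⟧
length-filterᵇ-allFin² {N} p = begin
  length (filterᵇ p (cartesianProduct (allFin N) (allFin N)))
    ≡⟨ length-filterᵇ p (cartesianProduct (allFin N) (allFin N)) ⟩
  listSum (map (⟦_⟧ ∘ p) (cartesianProduct (allFin N) (allFin N)))
    ≡⟨ listSum-cartesianProduct (⟦_⟧ ∘ p) (allFin N) (allFin N) ⟩
  listSum (map (λ s → listSum (map (λ t → ⟦ p (s , t) ⟧) (allFin N))) (allFin N))
    ≡⟨ listSum-allFin² (λ s t → ⟦ p (s , t) ⟧) ⟩
  ∑[ s < N ] ∑[ t < N ] ⟦ p (s , t) ⟧ ∎
  where open ≡-Reasoning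

sumBelow : ℕ → (ℕ → ℕ) → ℕ
sumBelow t f = ∑[ i < t ] f (toℕ i)

sumBelow-suc : ∀ t f → sumBelow (suc t) f ≡ sumBelow t f + f t
sumBelow-suc t f = trans (sum-init-last {t} (f ∘ toℕ))
  (cong₂ _+_ (sum-cong-≗ {t} (λ i → cong f (toℕ-inject₁ i))) (cong f (toℕ-fromℕ t)))

sumBelow-cong : ∀ t {f g} → (∀ d → d < t → f d ≡ g d) → sumBelow t f ≡ sumBelow t g
sumBelow-cong t f≗g = sum-cong-≗ {t} (λ i → f≗g (toℕ i) (toℕ<n i))

sumBelow-mono : ∀ t {f g} → (∀ d → d < t → f d ≤ g d) → sumBelow t f ≤ sumBelow t g
sumBelow-mono t f≤g = ∑-mono-≤ (λ i → f≤g (toℕ i) (toℕ<n i))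

sumBelow-+ : ∀ t f g → sumBelow t (λ d → f d + g d) ≡ sumBelow t f + sumBelow t g
sumBelow-+ t f g = ∑-distrib-+ {t} (f ∘ toℕ) (g ∘ toℕ)

sumBelow-extend : ∀ t k {f g} → (∀ d → d < t → g d ≡ f d) → (∀ d → t ≤ d → g d ≡ 0) →
                  sumBelow (t + k) g ≡ sumBelow t f
sumBelow-extend t zero {f} {g} g≗f _ = trans (cong (λ u → sumBelow u g) (+-identityʳ t)) (sumBelow-cong t g≗f)
sumBelow-extend t (suc k) {f} {g} g≗f g≡0 = begin
  sumBelow (t + suc k) g         ≡⟨ cong (λ u → sumBelow u g) (+-suc t k) ⟩
  sumBelow (suc (t + k)) g       ≡⟨ sumBelow-suc (t + k) g ⟩
  sumBelow (t + k) g + g (t + k) ≡⟨ cong₂ _+_ (sumBelow-extend t k g≗f g≡0) (g≡0 (t + k) (m≤m+n t k)) ⟩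
  sumBelow t f + 0               ≡⟨ +-identityʳ _ ⟩
  sumBelow t f                   ∎
  where open ≡-Reasoning

isYes-sound : ∀ {P : Set} {d : Dec P} → ⌊ d ⌋ ≡ true → P
isYes-sound {d = yes p} _ = p

isYes-complete : ∀ {P : Set} (d : Dec P) → P → ⌊ d ⌋ ≡ true
isYes-complete d p = trans (isYes≗does d) (dec-true d p)

anyBelow : ℕ → (ℕ → Bool) → Bool
anyBelow zero p = false
anyBelow (suc d) p = anyBelow d p ∨ p d

anyBelow-intro : ∀ {d} p {a} → a < d → p a ≡ true → anyBelow d p ≡ true
anyBelow-intro {suc d} p {a} a<d pa with anyBelow d p in below | a ≟ d
... | true | _ = refl
... | false | yes refl = pa
... | false | no a≢d = contradiction (trans (sym below) (anyBelow-intro p (≤∧≢⇒< (≤-pred a<d) a≢d) pa)) λ ()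

anyBelow-least : ∀ {d} p → anyBelow d p ≡ true → ∃[ a ] a < d × p a ≡ true × (∀ {a′} → a′ < a → p a′ ≡ false)
anyBelow-least {suc d} p found with anyBelow d p in below
... | true = let (a , a<d , pa , least) = anyBelow-least p below in a , m<n⇒m<1+n a<d , pa , least
... | false = d , ≤-refl , found , none
  where
    none : ∀ {a′} → a′ < d → p a′ ≡ false
    none {a′} a′<d with p a′ in pa′
    ... | false = refl
    ... | true = contradiction (trans (sym below) (anyBelow-intro p a′<d pa′)) λ ()

+0-≤ : ∀ {a b} → a ≤ b → a + 0 ≤ b
+0-≤ {a} = subst (_≤ _) (sym (+-identityʳ a))

count-singleton : ∀ a t → sumBelow t (λ d → ⟦ ⌊ d ≟ a ⌋ ⟧) ≤ 1
count-singleton a zero = z≤n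
count-singleton a (suc t) rewrite sumBelow-suc t (λ d → ⟦ ⌊ d ≟ a ⌋ ⟧) with t ≟ a
... | no _ = +0-≤ (count-singleton a t)
... | yes refl = subst (λ k → k + 1 ≤ 1) (sym none-before) ≤-refl
  where
    none-before : sumBelow t (λ d → ⟦ ⌊ d ≟ t ⌋ ⟧) ≡ 0
    none-before = ∑-zero (λ i → not-t (toℕ i) (toℕ<n i))
      where
        not-t : ∀ d → d < t → ⟦ ⌊ d ≟ t ⌋ ⟧ ≡ 0
        not-t d d<t with d ≟ t
        ... | yes refl = ⊥-elim (<-irrefl refl d<t)
        ... | no _ = refl

-- Positions are vertices in angular order around a vertex y: N d says that d is a neighbour of y
-- fitting the current spine edge, G d that the arc from y to d is extendable one level further.
module Reachability (N G : ℕ → Bool) (c : ℕ) where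

  countFrom : ℕ → ℕ → ℕ
  countFrom s t = sumBelow t (λ e → ⟦ ⌊ s ≤? e ⌋ ∧ N e ⟧)

  reachable : ℕ → Bool
  reachable d = anyBelow d (λ a → N a ∧ G a ∧ ⌊ c ≤? countFrom (suc a) d ⌋)

  amongFirst : ℕ → ℕ → Bool
  amongFirst s d = ⌊ s ≤? d ⌋ ∧ N d ∧ ⌊ countFrom s d <? c ⌋

  count-amongFirst : ∀ s t → sumBelow t (λ d → ⟦ amongFirst s d ⟧) ≤ c × sumBelow t (λ d → ⟦ amongFirst s d ⟧) ≤ countFrom s t
  count-amongFirst s zero = z≤n , z≤n
  count-amongFirst s (suc t)
    rewrite sumBelow-suc t (λ d → ⟦ amongFirst s d ⟧) | sumBelow-suc t (λ e → ⟦ ⌊ s ≤? e ⌋ ∧ N e ⟧)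
    with count-amongFirst s t | s ≤? t | N t | countFrom s t <? c
  ... | ≤c , ≤count | yes _ | true | yes count<c =
        ≤-trans (+-monoˡ-≤ 1 ≤count) (≤-trans (≤-reflexive (+-comm (countFrom s t) 1)) count<c) ,
        +-monoˡ-≤ 1 ≤count
  ... | ≤c , ≤count | yes _ | true | no _ = +0-≤ ≤c , +0-≤ (≤-trans ≤count (m≤m+n _ 1))
  ... | ≤c , ≤count | yes _ | false | _ = +0-≤ ≤c , +-monoˡ-≤ 0 ≤count
  ... | ≤c , ≤count | no _ | _ | _ = +0-≤ ≤c , +-monoˡ-≤ 0 ≤count

  unreachable-split : ∀ {a₀} → N a₀ ∧ G a₀ ≡ true → (∀ {a} → a < a₀ → N a ∧ G a ≡ false) → ∀ d →
    ⟦ N d ∧ not (reachable d) ⟧ ≤ ⟦ N d ∧ not (G d) ⟧ + (⟦ ⌊ d ≟ a₀ ⌋ ⟧ + ⟦ amongFirst (suc a₀) d ⟧)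
  unreachable-split {a₀} NGa₀ least d with N d in Nd | reachable d in reach | G d in Gd
  ... | false | _ | _ = z≤n
  ... | true | true | _ = z≤n
  ... | true | false | false = s≤s z≤n
  ... | true | false | true with d ≟ a₀
  ...   | yes _ = s≤s z≤n
  ...   | no d≢a₀ with suc a₀ ≤? d
  ...     | no a₀≮d = ⊥-elim (a₀≮d (≤∧≢⇒< a₀≤d (d≢a₀ ∘ sym)))
    where
      a₀≤d : a₀ ≤ d
      a₀≤d = ≮⇒≥ (λ d<a₀ → contradiction (trans (sym (least d<a₀)) (cong₂ _∧_ Nd Gd)) λ ())
  ...     | yes a₀<d with countFrom (suc a₀) d <? c
  ...       | yes _ = s≤s z≤n
  ...       | no c≤count = contradiction (trans (sym reach) (anyBelow-intro _ a₀<d witness)) λ ()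
    where
      witness : N a₀ ∧ G a₀ ∧ ⌊ c ≤? countFrom (suc a₀) d ⌋ ≡ true
      witness = trans (sym (∧-assoc (N a₀) (G a₀) _)) (cong₂ _∧_ NGa₀ (isYes-complete (c ≤? _) (≮⇒≥ c≤count)))

  count-unreachable : ∀ t → sumBelow t (λ d → ⟦ N d ∧ not (reachable d) ⟧)
                          ≤ sumBelow t (λ d → ⟦ N d ∧ not (G d) ⟧) + suc c
  count-unreachable t with anyBelow t (λ a → N a ∧ G a) in found
  ... | false = ≤-trans (sumBelow-mono t unreachable≤bad) (m≤m+n _ _)
    where
      unreachable≤bad : ∀ d → d < t → ⟦ N d ∧ not (reachable d) ⟧ ≤ ⟦ N d ∧ not (G d) ⟧
      unreachable≤bad d d<t with N d in Nd | G d in Gd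
      ... | false | _ = z≤n
      ... | true | false = ⟦⟧≤1 _
      ... | true | true = contradiction (trans (sym found) (anyBelow-intro {t} _ d<t (cong₂ _∧_ Nd Gd))) λ ()
  ... | true with anyBelow-least {t} (λ a → N a ∧ G a) found
  ...   | a₀ , _ , NGa₀ , least = begin
      sumBelow t (λ d → ⟦ N d ∧ not (reachable d) ⟧)
        ≤⟨ sumBelow-mono t (λ d _ → unreachable-split NGa₀ least d) ⟩
      sumBelow t (λ d → bad d + (at-a₀ d + after-a₀ d))
        ≡⟨ sumBelow-+ t bad (λ d → at-a₀ d + after-a₀ d) ⟩
      sumBelow t bad + sumBelow t (λ d → at-a₀ d + after-a₀ d)
        ≡⟨ cong (sumBelow t bad +_) (sumBelow-+ t at-a₀ after-a₀) ⟩
      sumBelow t bad + (sumBelow t at-a₀ + sumBelow t after-a₀)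
        ≤⟨ +-monoʳ-≤ (sumBelow t bad) (+-mono-≤ (count-singleton a₀ t) (proj₁ (count-amongFirst (suc a₀) t))) ⟩
      sumBelow t bad + suc c ∎
    where
      open ≤-Reasoning
      bad at-a₀ after-a₀ : ℕ → ℕ
      bad d = ⟦ N d ∧ not (G d) ⟧
      at-a₀ d = ⟦ ⌊ d ≟ a₀ ⌋ ⟧
      after-a₀ d = ⟦ amongFirst (suc a₀) d ⟧

lookup-injective : ∀ {B : Set} {ys : List B} → Unique ys → ∀ {i j} → lookup ys i ≡ lookup ys j → i ≡ j
lookup-injective (_ ∷ _) {fzero} {fzero} _ = refl
lookup-injective (y∉ys ∷ _) {fzero} {fsuc j} e = contradiction e (All.lookup y∉ys (∈-lookup j))
lookup-injective (y∉ys ∷ _) {fsuc i} {fzero} e = contradiction (sym e) (All.lookup y∉ys (∈-lookup i))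
lookup-injective (_ ∷ u) {fsuc i} {fsuc j} e = cong fsuc (lookup-injective u e)

module _ {A B : Set} (_≟_ : DecidableEquality A) where
  open DecMembership _≟_ using (_∈?_)

  injectionInto : (xs : List A) (ys : List B) → length xs ≤ length ys → Unique ys → B →
    Σ (A → B) λ φ → (∀ {a} → a ∈ xs → φ a ∈ ys) × (∀ {a a′} → a ∈ xs → a′ ∈ xs → φ a ≡ φ a′ → a ≡ a′)
  injectionInto xs ys xs≤ys unique default = φ , φ-into , φ-injective
    where
      slot : ∀ {a} → a ∈ xs → Fin (length ys)
      slot a∈xs = inject≤ (index a∈xs) xs≤ys
      φ : A → B
      φ a with a ∈? xs
      ... | yes a∈xs = lookup ys (slot a∈xs)
      ... | no _ = default
      φ-slot : ∀ {a} → a ∈ xs → Σ (a ∈ xs) λ a∈xs → φ a ≡ lookup ys (slot a∈xs)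
      φ-slot {a} a∈xs with a ∈? xs
      ... | yes a∈xs′ = a∈xs′ , refl
      ... | no a∉xs = contradiction a∈xs a∉xs
      φ-into : ∀ {a} → a ∈ xs → φ a ∈ ys
      φ-into a∈xs with φ-slot a∈xs
      ... | p , e = subst (_∈ ys) (sym e) (∈-lookup (slot p))
      φ-injective : ∀ {a a′} → a ∈ xs → a′ ∈ xs → φ a ≡ φ a′ → a ≡ a′
      φ-injective a∈xs a′∈xs e with φ-slot a∈xs | φ-slot a′∈xs
      ... | p , ep | p′ , ep′ = SetoidMembership.index-injective (setoid A) p p′
        (inject≤-injective xs≤ys xs≤ys (index p) (index p′) (lookup-injective unique (trans (sym ep) (trans e ep′))))

module CyclicOrder (m : ℕ) where

  n : ℕ
  n = suc m

  data IsCwDist (Y V r : ℕ) : Set where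
    forward : Y ≤ V → r + Y ≡ V → IsCwDist Y V r
    wrapped : V < Y → r + Y ≡ V + n → IsCwDist Y V r

  IsCwDist-unique : ∀ {Y V r r′} → IsCwDist Y V r → IsCwDist Y V r′ → r ≡ r′
  IsCwDist-unique {Y} {_} {r} {r′} (forward _ e) (forward _ e′) = +-cancelʳ-≡ Y r r′ (trans e (sym e′))
  IsCwDist-unique {Y} {_} {r} {r′} (wrapped _ e) (wrapped _ e′) = +-cancelʳ-≡ Y r r′ (trans e (sym e′))
  IsCwDist-unique (forward Y≤V _) (wrapped V<Y _) = contradiction Y≤V (<⇒≱ V<Y)
  IsCwDist-unique (wrapped V<Y _) (forward Y≤V _) = contradiction Y≤V (<⇒≱ V<Y)

  cwDist : Fin n → Fin n → ℕ
  cwDist y v with toℕ y ≤? toℕ v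
  ... | yes _ = toℕ v ∸ toℕ y
  ... | no _ = n ∸ toℕ y + toℕ v

  cwDist-view : ∀ y v → IsCwDist (toℕ y) (toℕ v) (cwDist y v)
  cwDist-view y v with toℕ y ≤? toℕ v
  ... | yes y≤v = forward y≤v (m∸n+n≡m y≤v)
  ... | no y≰v = wrapped (≰⇒> y≰v) (begin
      n ∸ Y + V + Y   ≡⟨ +-assoc (n ∸ Y) V Y ⟩
      n ∸ Y + (V + Y) ≡⟨ cong (n ∸ Y +_) (+-comm V Y) ⟩
      n ∸ Y + (Y + V) ≡⟨ +-assoc (n ∸ Y) Y V ⟨
      n ∸ Y + Y + V   ≡⟨ cong (_+ V) (m∸n+n≡m (<⇒≤ (toℕ<n y))) ⟩
      n + V           ≡⟨ +-comm n V ⟩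
      V + n           ∎)
    where
      open ≡-Reasoning
      Y V : ℕ
      Y = toℕ y
      V = toℕ v

  cwShift : Fin n → ℕ → Fin n
  cwShift y d = (toℕ y + d) mod n

  toℕ-cwShift : ∀ y d → toℕ (cwShift y d) ≡ (toℕ y + d) % n
  toℕ-cwShift y d = toℕ-fromℕ< _

  cwShift-view : ∀ y d → d < n → IsCwDist (toℕ y) (toℕ (cwShift y d)) d
  cwShift-view y d d<n rewrite toℕ-cwShift y d with toℕ y + d <? n
  ... | yes y+d<n rewrite m<n⇒m%n≡m y+d<n = forward (m≤m+n (toℕ y) d) (+-comm d (toℕ y))
  ... | no y+d≮n = subst (λ V → IsCwDist (toℕ y) V d) (sym y+d%n≡k)
                     (wrapped k<y (trans (+-comm d (toℕ y)) (sym k+n)))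
    where
      k : ℕ
      k = toℕ y + d ∸ n
      k+n : k + n ≡ toℕ y + d
      k+n = m∸n+n≡m (≮⇒≥ y+d≮n)
      k<y : k < toℕ y
      k<y = +-cancelʳ-< n k (toℕ y) (subst (_< toℕ y + n) (sym k+n) (+-monoʳ-< (toℕ y) d<n))
      y+d%n≡k : (toℕ y + d) % n ≡ k
      y+d%n≡k = begin
        (toℕ y + d) % n ≡⟨ cong (_% n) k+n ⟨
        (k + n) % n     ≡⟨ [m+n]%n≡m%n k n ⟩
        k % n           ≡⟨ m<n⇒m%n≡m (<-trans k<y (toℕ<n y)) ⟩
        k               ∎
        where open ≡-Reasoning

  cwDist<n : ∀ y v → cwDist y v < n
  cwDist<n y v with cwDist-view y v
  ... | forward _ e = ≤-<-trans (m≤m+n (cwDist y v) (toℕ y)) (subst (_< n) (sym e) (toℕ<n v))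
  ... | wrapped v<y e = +-cancelʳ-< (toℕ y) (cwDist y v) n
                          (subst (_< n + toℕ y) (sym e) (subst (toℕ v + n <_) (+-comm (toℕ y) n) (+-monoˡ-< n v<y)))

  cwDist-cwShift : ∀ y d → d < n → cwDist y (cwShift y d) ≡ d
  cwDist-cwShift y d d<n = IsCwDist-unique (cwDist-view y (cwShift y d)) (cwShift-view y d d<n)

  cwShift-cwDist : ∀ y v → cwShift y (cwDist y v) ≡ v
  cwShift-cwDist y v = toℕ-injective (trans (toℕ-cwShift y (cwDist y v)) (reduce (cwDist-view y v)))
    where
      reduce : IsCwDist (toℕ y) (toℕ v) (cwDist y v) → (toℕ y + cwDist y v) % n ≡ toℕ v
      reduce (forward _ e) rewrite +-comm (toℕ y) (cwDist y v) | e = m<n⇒m%n≡m (toℕ<n v)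
      reduce (wrapped _ e) rewrite +-comm (toℕ y) (cwDist y v) | e =
        trans ([m+n]%n≡m%n (toℕ v) n) (m<n⇒m%n≡m (toℕ<n v))

  cwDist-self : ∀ y → cwDist y y ≡ 0
  cwDist-self y = IsCwDist-unique (cwDist-view y y) (forward ≤-refl refl)

  cwDist-injective : ∀ y {v v′} → cwDist y v ≡ cwDist y v′ → v ≡ v′
  cwDist-injective y {v} {v′} e = trans (sym (cwShift-cwDist y v)) (trans (cong (cwShift y) e) (cwShift-cwDist y v′))

  cwDist-pos : ∀ y v → v ≢ y → 0 < cwDist y v
  cwDist-pos y v v≢y with cwDist y v in e
  ... | zero = contradiction (cwDist-injective y (trans e (sym (cwDist-self y)))) v≢y
  ... | suc _ = s≤s z≤n

  private
    cancel< : ∀ {a b A B Y} → a + Y ≡ A → b + Y ≡ B → A < B → a < b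
    cancel< {a} {b} {Y = Y} refl refl = +-cancelʳ-< Y a b

    uncancel< : ∀ {a b A B Y} → a + Y ≡ A → b + Y ≡ B → a < b → A < B
    uncancel< {Y = Y} refl refl = +-monoˡ-< Y

    <n≤+n : ∀ {V W} → V < n → V < W + n
    <n≤+n {V} {W} V<n = <-≤-trans V<n (m≤n+m n W)

  between⇒cwDist-from-end< : ∀ x y w → Between x y w → cwDist y x < cwDist y w
  between⇒cwDist-from-end< x y w b with cwDist-view y x | cwDist-view y w | b
  ... | wrapped _ ex | wrapped _ ew | inj₁ (x<w , _) = cancel< ex ew (+-monoˡ-< n x<w)
  ... | forward _ ex | forward _ ew | inj₂ (inj₁ (_ , x<w)) = cancel< ex ew x<w
  ... | forward _ ex | wrapped _ ew | inj₂ (inj₂ _) = cancel< ex ew (<n≤+n (toℕ<n x))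
  ... | forward y≤x _ | _ | inj₁ (x<w , w<y) = ⊥-elim (<⇒≱ (<-trans x<w w<y) y≤x)
  ... | wrapped x<y _ | _ | inj₂ (inj₁ (y<x , _)) = ⊥-elim (<⇒≱ x<y (<⇒≤ y<x))
  ... | wrapped x<y _ | _ | inj₂ (inj₂ (y<x , _)) = ⊥-elim (<⇒≱ x<y (<⇒≤ y<x))
  ... | _ | forward y≤w _ | inj₁ (_ , w<y) = ⊥-elim (<⇒≱ w<y y≤w)
  ... | _ | wrapped w<y _ | inj₂ (inj₁ (y<x , x<w)) = ⊥-elim (<⇒≱ (<-trans y<x x<w) (<⇒≤ w<y))
  ... | _ | forward y≤w _ | inj₂ (inj₂ (_ , w<y)) = ⊥-elim (<⇒≱ w<y y≤w)

  cwDist-from-end<⇒between : ∀ x y w → x ≢ y → cwDist y x < cwDist y w → Between x y w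
  cwDist-from-end<⇒between x y w x≢y lt with cwDist-view y x | cwDist-view y w
  ... | forward y≤x ex | forward _ ew = inj₂ (inj₁ (≤∧≢⇒<ᶠ y≤x (x≢y ∘ sym) , uncancel< ex ew lt))
  ... | forward y≤x _ | wrapped w<y _ = inj₂ (inj₂ (≤∧≢⇒<ᶠ y≤x (x≢y ∘ sym) , w<y))
  ... | wrapped _ ex | forward _ ew = ⊥-elim (<⇒≱ (uncancel< ex ew lt) (≤-trans (<⇒≤ (toℕ<n w)) (m≤n+m n (toℕ x))))
  ... | wrapped _ ex | wrapped w<y ew = inj₁ (+-cancelʳ-< n (toℕ x) (toℕ w) (uncancel< ex ew lt) , w<y)

  between⇒cwDist-from-start< : ∀ y z w → Between y z w → cwDist y w < cwDist y z
  between⇒cwDist-from-start< y z w b with cwDist-view y w | cwDist-view y z | b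
  ... | forward _ ew | forward _ ez | inj₁ (_ , w<z) = cancel< ew ez w<z
  ... | forward _ ew | wrapped _ ez | inj₂ (inj₁ _) = cancel< ew ez (<n≤+n (toℕ<n w))
  ... | wrapped _ ew | wrapped _ ez | inj₂ (inj₂ (_ , w<z)) = cancel< ew ez (+-monoˡ-< n w<z)
  ... | wrapped w<y _ | _ | inj₁ (y<w , _) = ⊥-elim (<⇒≱ w<y (<⇒≤ y<w))
  ... | _ | wrapped z<y _ | inj₁ (y<w , w<z) = ⊥-elim (<⇒≱ (<-trans y<w w<z) (<⇒≤ z<y))
  ... | wrapped w<y _ | _ | inj₂ (inj₁ (_ , y<w)) = ⊥-elim (<⇒≱ w<y (<⇒≤ y<w))
  ... | _ | forward y≤z _ | inj₂ (inj₁ (z<y , _)) = ⊥-elim (<⇒≱ z<y y≤z)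
  ... | _ | forward y≤z _ | inj₂ (inj₂ (z<y , _)) = ⊥-elim (<⇒≱ z<y y≤z)
  ... | forward y≤w _ | wrapped _ _ | inj₂ (inj₂ (z<y , w<z)) = ⊥-elim (<⇒≱ (<-trans w<z z<y) y≤w)

  cwDist-from-start<⇒between : ∀ y z w → w ≢ y → cwDist y w < cwDist y z → Between y z w
  cwDist-from-start<⇒between y z w w≢y lt with cwDist-view y w | cwDist-view y z
  ... | forward y≤w ew | forward _ ez = inj₁ (≤∧≢⇒<ᶠ y≤w (w≢y ∘ sym) , uncancel< ew ez lt)
  ... | forward y≤w _ | wrapped z<y _ = inj₂ (inj₁ (z<y , ≤∧≢⇒<ᶠ y≤w (w≢y ∘ sym)))
  ... | wrapped _ ew | forward _ ez = ⊥-elim (<⇒≱ (uncancel< ew ez lt) (≤-trans (<⇒≤ (toℕ<n z)) (m≤n+m n (toℕ w))))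
  ... | wrapped _ ew | wrapped z<y ez = inj₂ (inj₂ (z<y , +-cancelʳ-< n (toℕ w) (toℕ z) (uncancel< ew ez lt)))

  negMod : ℕ → ℕ
  negMod zero = zero
  negMod (suc d) = n ∸ suc d

  negMod<n : ∀ d → negMod d < n
  negMod<n zero = s≤s z≤n
  negMod<n (suc d) = s≤s (m∸n≤m m d)

  negMod-involutive : ∀ d → d < n → negMod (negMod d) ≡ d
  negMod-involutive zero _ = refl
  negMod-involutive (suc d) (s≤s d<m) with m ∸ d in e
  ... | zero = contradiction e (m>n⇒m∸n≢0 d<m)
  ... | suc k = trans (cong (n ∸_) (sym e)) (m∸[m∸n]≡n (s≤s (<⇒≤ d<m)))

  negMod-antitone : ∀ {a b} → 0 < a → a ≤ b → negMod b ≤ negMod a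
  negMod-antitone {suc a} {suc b} _ a≤b = ∸-monoʳ-≤ n a≤b

  negMod-reflects-≤ : ∀ {a b} → 0 < a → 0 < b → b < n → negMod a ≤ negMod b → b ≤ a
  negMod-reflects-≤ {suc a} {suc b} _ _ b<n le with suc b ≤? suc a
  ... | yes b≤a = b≤a
  ... | no b≰a = ⊥-elim (<⇒≱ (∸-monoʳ-< {n} {suc b} {suc a} (≰⇒> b≰a) (<⇒≤ b<n)) le)

  orient : Bool → ℕ → ℕ
  orient true d = d
  orient false d = negMod d

  orient<n : ∀ b {d} → d < n → orient b d < n
  orient<n true d<n = d<n
  orient<n false {d} _ = negMod<n d

  orient-involutive : ∀ b {d} → d < n → orient b (orient b d) ≡ d
  orient-involutive true _ = refl
  orient-involutive false {d} d<n = negMod-involutive d d<n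

  offset : Bool → Fin n → Fin n → ℕ
  offset b y v = orient b (cwDist y v)

  atOffset : Bool → Fin n → ℕ → Fin n
  atOffset b y d = cwShift y (orient b d)

  offset<n : ∀ b y v → offset b y v < n
  offset<n b y v = orient<n b (cwDist<n y v)

  offset-self : ∀ b y → offset b y y ≡ 0
  offset-self true y = cwDist-self y
  offset-self false y = cong negMod (cwDist-self y)

  offset-atOffset : ∀ b y {d} → d < n → offset b y (atOffset b y d) ≡ d
  offset-atOffset b y {d} d<n =
    trans (cong (orient b) (cwDist-cwShift y (orient b d) (orient<n b d<n))) (orient-involutive b d<n)

  atOffset-offset : ∀ b y v → atOffset b y (offset b y v) ≡ v
  atOffset-offset b y v = trans (cong (cwShift y) (orient-involutive b (cwDist<n y v))) (cwShift-cwDist y v)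

  Allowed : Bool → Fin n → Fin n → Fin n → Set
  Allowed true x y w = ¬ Between x y w
  Allowed false x y w = ¬ Outside x y w

  offset≤⇒allowed : ∀ b {x y w} → x ≢ y → offset b y w ≤ offset b y x → Allowed b x y w
  offset≤⇒allowed true {x} {y} {w} _ w≤x between = <⇒≱ (between⇒cwDist-from-end< x y w between) w≤x
  offset≤⇒allowed false {x} {y} {w} x≢y w≤x (w≢x , w≢y , ¬between) =
    ¬between (cwDist-from-end<⇒between x y w x≢y (≤∧≢⇒< x≤w (w≢x ∘ cwDist-injective y ∘ sym)))
    where
      x≤w : cwDist y x ≤ cwDist y w
      x≤w = negMod-reflects-≤ (cwDist-pos y w w≢y) (cwDist-pos y x x≢y) (cwDist<n y x) w≤x

  allowed⇒offset≤ : ∀ b {y z w} → z ≢ y → Allowed b y z w → offset (not b) y w ≤ offset (not b) y z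
  allowed⇒offset≤ false {y} {z} {w} _ ¬outside with cwDist y w ≤? cwDist y z
  ... | yes w≤z = w≤z
  ... | no w≰z = ⊥-elim (¬outside (w≢y , w≢z , <⇒≱ z<w ∘ <⇒≤ ∘ between⇒cwDist-from-start< y z w))
    where
      z<w : cwDist y z < cwDist y w
      z<w = ≰⇒> w≰z
      w≢y : w ≢ y
      w≢y refl = <⇒≱ z<w (subst (_≤ cwDist y z) (sym (cwDist-self y)) z≤n)
      w≢z : w ≢ z
      w≢z refl = <-irrefl refl z<w
  allowed⇒offset≤ true {y} {z} {w} z≢y ¬between with w ≟ᶠ y
  ... | yes refl = subst (_≤ offset false y z) (sym (offset-self false y)) z≤n
  ... | no w≢y = negMod-antitone (cwDist-pos y z z≢y)
                   (≮⇒≥ (¬between ∘ cwDist-from-start<⇒between y z w w≢y))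

  ∑-by-offset : ∀ b y (h : Fin n → ℕ) → ∑[ v < n ] h v ≡ sumBelow n (λ d → h (atOffset b y d))
  ∑-by-offset b y h = ∑-permute h π
    where
      π : Permutation n n
      π = permutation (atOffset b y ∘ toℕ) (λ v → fromℕ< (offset<n b y v))
            (λ v → trans (cong (atOffset b y) (toℕ-fromℕ< _)) (atOffset-offset b y v))
            (λ i → toℕ-injective (trans (toℕ-fromℕ< _) (offset-atOffset b y (toℕ<n i))))

  count-window : ∀ b y (p : ℕ → Bool) s t → t ≤ n →
    length (filterᵇ (λ v → ⌊ s ≤? offset b y v ⌋ ∧ ⌊ offset b y v <? t ⌋ ∧ p (offset b y v)) (allFin n))
      ≡ sumBelow t (λ d → ⟦ ⌊ s ≤? d ⌋ ∧ p d ⟧)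
  count-window b y p s t t≤n = begin
    length (filterᵇ (inWindow ∘ offset b y) (allFin n))
      ≡⟨ length-filterᵇ-allFin (inWindow ∘ offset b y) ⟩
    ∑[ v < n ] ⟦ inWindow (offset b y v) ⟧
      ≡⟨ ∑-by-offset b y (⟦_⟧ ∘ inWindow ∘ offset b y) ⟩
    sumBelow n (λ d → ⟦ inWindow (offset b y (atOffset b y d)) ⟧)
      ≡⟨ sumBelow-cong n (λ d d<n → cong (⟦_⟧ ∘ inWindow) (offset-atOffset b y d<n)) ⟩
    sumBelow n (⟦_⟧ ∘ inWindow)
      ≡⟨ cong (λ u → sumBelow u (⟦_⟧ ∘ inWindow)) (m+[n∸m]≡n t≤n) ⟨
    sumBelow (t + (n ∸ t)) (⟦_⟧ ∘ inWindow)
      ≡⟨ sumBelow-extend t (n ∸ t) inside outside ⟩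
    sumBelow t (λ d → ⟦ ⌊ s ≤? d ⌋ ∧ p d ⟧) ∎
    where
      open ≡-Reasoning
      inWindow : ℕ → Bool
      inWindow d = ⌊ s ≤? d ⌋ ∧ ⌊ d <? t ⌋ ∧ p d
      inside : ∀ d → d < t → ⟦ inWindow d ⟧ ≡ ⟦ ⌊ s ≤? d ⌋ ∧ p d ⟧
      inside d d<t with d <? t
      ... | yes _ = refl
      ... | no d≮t = contradiction d<t d≮t
      outside : ∀ d → t ≤ d → ⟦ inWindow d ⟧ ≡ 0
      outside d t≤d with d <? t
      ... | yes d<t = contradiction t≤d (<⇒≱ d<t)
      ... | no _ = cong ⟦_⟧ (∧-zeroʳ _)

if-yes : ∀ {A P : Set} (d : Dec P) {a b : A} → P → (if does d then a else b) ≡ a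
if-yes d p rewrite dec-true d p = refl

if-no : ∀ {A P : Set} (d : Dec P) {a b : A} → ¬ P → (if does d then a else b) ≡ b
if-no d ¬p rewrite dec-false d ¬p = refl

∧-true : ∀ {a b} → a ∧ b ≡ true → a ≡ true × b ≡ true
∧-true {true} e = refl , e


odd : ℕ → Bool
odd zero = false
odd (suc k) = not (odd k)

odd-%2≡1 : ∀ k → k % 2 ≡ 1 → odd k ≡ true
odd-%2≡1 (suc zero) _ = refl
odd-%2≡1 (suc (suc k)) h = trans (not-involutive (odd k)) (odd-%2≡1 k h)

odd-%2≡0 : ∀ k → k % 2 ≡ 0 → odd k ≡ false
odd-%2≡0 zero _ = refl
odd-%2≡0 (suc (suc k)) h = trans (not-involutive (odd k)) (odd-%2≡0 k h)

module Construction (m : ℕ) (D : ConvexDigraph (suc m)) (T : OrientedCaterpillar)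
                    (antidirected : Antidirected T) where
  open CyclicOrder m

  Q L : ℕ
  Q = q T
  L = ℓ T

  spineAt : ℕ → Fin (2 + Q)
  spineAt j = j mod (2 + Q)

  toℕ-spineAt : ∀ {j} → j < 2 + Q → toℕ (spineAt j) ≡ j
  toℕ-spineAt {j} j<2+Q = trans (toℕ-fromℕ< _) (m<n⇒m%n≡m j<2+Q)

  spineAt-consecutive : ∀ {j} → j < suc Q → toℕ (spineAt (suc j)) ≡ suc (toℕ (spineAt j))
  spineAt-consecutive j<1+Q = trans (toℕ-spineAt (s≤s j<1+Q)) (cong suc (sym (toℕ-spineAt (m<n⇒m<1+n j<1+Q))))

  spineDir : ℕ → Bool
  spineDir j = sdir T (spineAt j)

  sdir≡spineDir : ∀ i {j} → toℕ i ≡ j → sdir T i ≡ spineDir j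
  sdir≡spineDir i {j} refl = cong (sdir T) (toℕ-injective (sym (toℕ-spineAt (toℕ<n i))))

  attN : Fin L → ℕ
  attN l = toℕ (att T l)

  fits : ℕ → Fin n → Fin n → Bool
  fits j x y = if spineDir j then adj D x y else adj D y x

  fits⇒arc : ∀ j {x y} → spineDir j ≡ true → fits j x y ≡ true → Arc D x y
  fits⇒arc j dir f rewrite dir = f

  fits⇒arc⁻ : ∀ j {x y} → spineDir j ≡ false → fits j x y ≡ true → Arc D y x
  fits⇒arc⁻ j dir f rewrite dir = f

  fits⇒≢ : ∀ j {x y} → fits j x y ≡ true → x ≢ y
  fits⇒≢ j {x} f refl with spineDir j
  ... | true = contradiction (trans (sym (loopless D x)) f) λ ()
  ... | false = contradiction (trans (sym (loopless D x)) f) λ ()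

  spineDir-alternates : ∀ {j} → j < Q → spineDir (suc j) ≡ not (spineDir j)
  spineDir-alternates {j} j<Q with spineDir j in dⱼ | spineDir (suc j) in dⱼ₊₁
  ... | true | false = refl
  ... | false | true = refl
  ... | true | true = ⊥-elim (antidirected _ _ _ (spineF _ _ (spineAt-consecutive (m<n⇒m<1+n j<Q)) dⱼ)
                                                 (spineF _ _ (spineAt-consecutive (s≤s j<Q)) dⱼ₊₁))
  ... | false | false = ⊥-elim (antidirected _ _ _ (spineB _ _ (spineAt-consecutive (s≤s j<Q)) dⱼ₊₁)
                                                   (spineB _ _ (spineAt-consecutive (m<n⇒m<1+n j<Q)) dⱼ))

  fits-suc : ∀ {j} → j < Q → ∀ v y → fits (suc j) y v ≡ fits j v y
  fits-suc {j} j<Q v y rewrite spineDir-alternates j<Q with spineDir j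
  ... | true = refl
  ... | false = refl

  att≡suc⇒consecutive : ∀ l {j} → attN l ≡ suc j → toℕ (att T l) ≡ suc (toℕ (spineAt j))
  att≡suc⇒consecutive l {j} e =
    trans e (cong suc (sym (toℕ-spineAt (<-trans (n<1+n j) (subst (_< 2 + Q) e (toℕ<n (att T l)))))))

  outLeaf⇒backward : ∀ l {j} → attN l ≡ suc j → ldir T l ≡ true → spineDir j ≡ false
  outLeaf⇒backward l {j} e out with spineDir j in dⱼ
  ... | false = refl
  ... | true = ⊥-elim (antidirected _ _ _ (spineF _ _ (att≡suc⇒consecutive l e) dⱼ) (leafF l out))

  inLeaf⇒forward : ∀ l {j} → attN l ≡ suc j → ldir T l ≡ false → spineDir j ≡ true
  inLeaf⇒forward l {j} e in′ with spineDir j in dⱼ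
  ... | true = refl
  ... | false = ⊥-elim (antidirected _ _ _ (leafB l in′) (spineB _ _ (att≡suc⇒consecutive l e) dⱼ))

  <Q : ∀ r {j} → suc r + j ≡ Q → j < Q
  <Q r {j} r+j≡Q = subst (j <_) r+j≡Q (s≤s (m≤n+m j r))

  last-spine : ∀ (i : Fin (2 + Q)) → Q ≤ toℕ i → toℕ i ≡ Q ⊎ toℕ i ≡ suc Q
  last-spine i Q≤i with toℕ i ≟ Q
  ... | yes e = inj₁ e
  ... | no ne = inj₂ (≤-antisym (≤-pred (toℕ<n i)) (≤∧≢⇒< Q≤i (ne ∘ sym)))

  last-spine-edge : ∀ {i i′ : Fin (2 + Q)} → Q ≤ toℕ i → toℕ i′ ≡ suc (toℕ i) → toℕ i ≡ Q
  last-spine-edge {i′ = i′} Q≤i e = ≤-antisym (≤-pred (≤-pred (subst (_< 2 + Q) e (toℕ<n i′)))) Q≤i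

  no-leaf-beyond-Q : ∀ l → ¬ (Q < attN l)
  no-leaf-beyond-Q l Q<l = <⇒≱ Q<l (proj₂ (inner T l))

  InTail : ℕ → Vtx T → Set
  InTail j (inj₁ i) = j ≤ toℕ i
  InTail j (inj₂ l) = j < attN l

  -- The part of T beyond spine vertex j, which has r + 2 spine vertices; odd r is its spine parity.
  record TailEmbedding (r j : ℕ) (x y : Fin n) : Set where
    field
      g : Vtx T → Fin n
      g-start : ∀ i → toℕ i ≡ j → g (inj₁ i) ≡ x
      g-next : ∀ i → toℕ i ≡ suc j → g (inj₁ i) ≡ y
      g-injective : ∀ u v → InTail j u → InTail j v → g u ≡ g v → u ≡ v
      g-arcs : ∀ u v → InTail j u → InTail j v → TArc T u v → Arc D (g u) (g v)
      g-allowed : ∀ v → InTail j v → Allowed (odd r) x y (g v)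

  lastEdgeEmbedding : ∀ x y → fits Q x y ≡ true → TailEmbedding 0 Q x y
  lastEdgeEmbedding x y fitsxy = record
    { g = g ; g-start = g-start ; g-next = g-next
    ; g-injective = g-injective ; g-arcs = g-arcs ; g-allowed = g-allowed }
    where
      x≢y = fits⇒≢ Q fitsxy
      g : Vtx T → Fin n
      g (inj₁ i) = if does (toℕ i ≟ Q) then x else y
      g (inj₂ l) = x
      g-start : ∀ i → toℕ i ≡ Q → g (inj₁ i) ≡ x
      g-start i e = if-yes (toℕ i ≟ Q) e
      g-next : ∀ i → toℕ i ≡ suc Q → g (inj₁ i) ≡ y
      g-next i e = if-no (toℕ i ≟ Q) (λ e′ → <-irrefl (trans (sym e′) e) (n<1+n Q))
      g-injective : ∀ u v → InTail Q u → InTail Q v → g u ≡ g v → u ≡ v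
      g-injective (inj₁ i) (inj₁ i′) Q≤i Q≤i′ e with last-spine i Q≤i | last-spine i′ Q≤i′
      ... | inj₁ p | inj₁ p′ = cong inj₁ (toℕ-injective (trans p (sym p′)))
      ... | inj₂ p | inj₂ p′ = cong inj₁ (toℕ-injective (trans p (sym p′)))
      ... | inj₁ p | inj₂ p′ = ⊥-elim (x≢y (trans (sym (g-start i p)) (trans e (g-next i′ p′))))
      ... | inj₂ p | inj₁ p′ = ⊥-elim (x≢y (trans (sym (g-start i′ p′)) (trans (sym e) (g-next i p))))
      g-injective (inj₂ l) _ Q<l _ _ = ⊥-elim (no-leaf-beyond-Q l Q<l)
      g-injective (inj₁ _) (inj₂ l) _ Q<l _ = ⊥-elim (no-leaf-beyond-Q l Q<l)
      g-arcs : ∀ u v → InTail Q u → InTail Q v → TArc T u v → Arc D (g u) (g v)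
      g-arcs _ _ Q≤i _ (spineF i i′ e dir) =
        let i≡Q = last-spine-edge Q≤i e in
        subst₂ (Arc D) (sym (g-start i i≡Q)) (sym (g-next i′ (trans e (cong suc i≡Q))))
          (fits⇒arc Q (trans (sym (sdir≡spineDir i i≡Q)) dir) fitsxy)
      g-arcs _ _ _ Q≤i (spineB i i′ e dir) =
        let i≡Q = last-spine-edge Q≤i e in
        subst₂ (Arc D) (sym (g-next i′ (trans e (cong suc i≡Q)))) (sym (g-start i i≡Q))
          (fits⇒arc⁻ Q (trans (sym (sdir≡spineDir i i≡Q)) dir) fitsxy)
      g-arcs _ _ _ Q<l (leafF l _) = ⊥-elim (no-leaf-beyond-Q l Q<l)
      g-arcs _ _ Q<l _ (leafB l _) = ⊥-elim (no-leaf-beyond-Q l Q<l)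
      g-allowed : ∀ v → InTail Q v → Allowed false x y (g v)
      g-allowed (inj₁ i) Q≤i with last-spine i Q≤i
      ... | inj₁ p = λ outside → proj₁ outside (g-start i p)
      ... | inj₂ p = λ outside → proj₁ (proj₂ outside) (g-next i p)
      g-allowed (inj₂ l) Q<l = ⊥-elim (no-leaf-beyond-Q l Q<l)

  leavesAt : ℕ → List (Fin L)
  leavesAt k = filterᵇ (λ l → ⌊ attN l ≟ k ⌋) (allFin L)

  ∈-leavesAt : ∀ l {k} → attN l ≡ k → l ∈ leavesAt k
  ∈-leavesAt l e = ∈-filter⁺ (T? ∘ _) (∈-allFin l) (fromWitness e)

  candidate : Bool → ℕ → Fin n → ℕ → Bool
  candidate b j y d = fits j (atOffset b y d) y

  LeafPlacement : ℕ → Bool → Fin n → ℕ → ℕ → Set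
  LeafPlacement j b y lo hi = Σ (Fin L → Fin n) λ φ →
      (∀ l → attN l ≡ suc j → lo < offset b y (φ l) × offset b y (φ l) < hi × fits j (φ l) y ≡ true)
    × (∀ l l′ → attN l ≡ suc j → attN l′ ≡ suc j → φ l ≡ φ l′ → l ≡ l′)

  placeLeaves : ∀ j b y lo hi → hi ≤ n →
    length (leavesAt (suc j)) ≤ sumBelow hi (λ d → ⟦ ⌊ suc lo ≤? d ⌋ ∧ candidate b j y d ⟧) →
    LeafPlacement j b y lo hi
  placeLeaves j b y lo hi hi≤n room = φ , φ-range , φ-injective
    where
      σ = offset b y
      inWindow : Fin n → Bool
      inWindow v = ⌊ suc lo ≤? σ v ⌋ ∧ ⌊ σ v <? hi ⌋ ∧ candidate b j y (σ v)
      targets : List (Fin n)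
      targets = filterᵇ inWindow (allFin n)
      injection = injectionInto _≟ᶠ_ (leavesAt (suc j)) targets
        (subst (_ ≤_) (sym (count-window b y (candidate b j y) (suc lo) hi hi≤n)) room)
        (Unique.filter⁺ (T? ∘ inWindow) (Unique.allFin⁺ n)) y
      φ : Fin L → Fin n
      φ = proj₁ injection
      φ-range : ∀ l → attN l ≡ suc j → lo < σ (φ l) × σ (φ l) < hi × fits j (φ l) y ≡ true
      φ-range l e = isYes-sound {d = suc lo ≤? _} (proj₁ lower)
                  , isYes-sound {d = _ <? hi} (proj₁ upper)
                  , trans (cong (λ v → fits j v y) (sym (atOffset-offset b y (φ l)))) (proj₂ upper)
        where
          φl∈targets : inWindow (φ l) ≡ true
          φl∈targets = Equivalence.to T-≡
            (proj₂ (∈-filter⁻ (T? ∘ inWindow) (proj₁ (proj₂ injection) (∈-leavesAt l e))))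
          lower = ∧-true {⌊ suc lo ≤? σ (φ l) ⌋} φl∈targets
          upper = ∧-true {⌊ σ (φ l) <? hi ⌋} (proj₂ lower)
      φ-injective : ∀ l l′ → attN l ≡ suc j → attN l′ ≡ suc j → φ l ≡ φ l′ → l ≡ l′
      φ-injective l l′ e e′ = proj₂ (proj₂ injection) (∈-leavesAt l e) (∈-leavesAt l′ e′)

  -- In the angular order around y the old part lies up to z and the new leaves lie strictly between
  -- z and x, so every image lies up to x, which is what Allowed needs.
  module Extend {r j : ℕ} {x y z : Fin n} (tail : TailEmbedding r (suc j) y z) (fitsxy : fits j x y ≡ true)
    (z≢y : z ≢ y) (z<x : offset (odd (suc r)) y z < offset (odd (suc r)) y x)
    (leaves : LeafPlacement j (odd (suc r)) y (offset (odd (suc r)) y z) (offset (odd (suc r)) y x)) where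

    open TailEmbedding tail using () renaming
      (g to g₀; g-start to g₀-start; g-injective to g₀-injective; g-arcs to g₀-arcs; g-allowed to g₀-allowed)

    σ : Fin n → ℕ
    σ = offset (odd (suc r)) y

    φ = proj₁ leaves
    φ-range = proj₁ (proj₂ leaves)
    φ-injective = proj₂ (proj₂ leaves)

    x≢y : x ≢ y
    x≢y = fits⇒≢ j fitsxy

    old≤z : ∀ v → InTail (suc j) v → σ (g₀ v) ≤ σ z
    old≤z v v∈ = allowed⇒offset≤ (odd r) z≢y (g₀-allowed v v∈)

    g : Vtx T → Fin n
    g (inj₁ i) = if does (toℕ i ≟ j) then x else g₀ (inj₁ i)
    g (inj₂ l) = if does (attN l ≟ suc j) then φ l else g₀ (inj₂ l)

    g-start : ∀ i → toℕ i ≡ j → g (inj₁ i) ≡ x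
    g-start i e = if-yes (toℕ i ≟ j) e

    g-old-spine : ∀ i → toℕ i ≢ j → g (inj₁ i) ≡ g₀ (inj₁ i)
    g-old-spine i ne = if-no (toℕ i ≟ j) ne

    g-next : ∀ i → toℕ i ≡ suc j → g (inj₁ i) ≡ y
    g-next i e = trans (g-old-spine i (λ e′ → <-irrefl (trans (sym e′) e) (n<1+n j))) (g₀-start i e)

    g-new-leaf : ∀ l → attN l ≡ suc j → g (inj₂ l) ≡ φ l
    g-new-leaf l e = if-yes (attN l ≟ suc j) e

    g-old-leaf : ∀ l → attN l ≢ suc j → g (inj₂ l) ≡ g₀ (inj₂ l)
    g-old-leaf l ne = if-no (attN l ≟ suc j) ne

    data Part : Vtx T → Set where
      start : ∀ i → toℕ i ≡ j → Part (inj₁ i)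
      new-leaf : ∀ l → attN l ≡ suc j → Part (inj₂ l)
      old : ∀ v → InTail (suc j) v → g v ≡ g₀ v → Part v

    part : ∀ v → InTail j v → Part v
    part (inj₁ i) j≤i with toℕ i ≟ j
    ... | yes e = start i e
    ... | no ne = old (inj₁ i) (≤∧≢⇒< j≤i (ne ∘ sym)) (g-old-spine i ne)
    part (inj₂ l) j<l with attN l ≟ suc j
    ... | yes e = new-leaf l e
    ... | no ne = old (inj₂ l) (≤∧≢⇒< j<l (ne ∘ sym)) (g-old-leaf l ne)

    ≤x : ∀ {v} → Part v → σ (g v) ≤ σ x
    ≤x (start i e) = ≤-reflexive (cong σ (g-start i e))
    ≤x (new-leaf l e) = subst (λ w → σ w ≤ σ x) (sym (g-new-leaf l e)) (<⇒≤ (proj₁ (proj₂ (φ-range l e))))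
    ≤x (old v v∈ e) = subst (λ w → σ w ≤ σ x) (sym e) (≤-trans (old≤z v v∈) (<⇒≤ z<x))

    separated : ∀ {w w′} → σ w < σ w′ → w ≢ w′
    separated lt refl = <-irrefl refl lt

    old≢new : ∀ {u} → InTail (suc j) u → g u ≡ g₀ u → ∀ {w} → σ z < σ w → g u ≢ w
    old≢new {u} u∈ e z<w = separated (<-≤-trans (s≤s (subst (λ w → σ w ≤ σ z) (sym e) (old≤z u u∈))) z<w)

    injective-on-parts : ∀ {u v} → Part u → Part v → g u ≡ g v → u ≡ v
    injective-on-parts (start i e) (start i′ e′) _ = cong inj₁ (toℕ-injective (trans e (sym e′)))
    injective-on-parts (new-leaf l e) (new-leaf l′ e′) eq =
      cong inj₂ (φ-injective l l′ e e′ (trans (sym (g-new-leaf l e)) (trans eq (g-new-leaf l′ e′))))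
    injective-on-parts (old u u∈ e) (old v v∈ e′) eq = g₀-injective u v u∈ v∈ (trans (sym e) (trans eq e′))
    injective-on-parts (start i e) (new-leaf l e′) eq =
      ⊥-elim (separated (proj₁ (proj₂ (φ-range l e′))) (trans (sym (g-new-leaf l e′)) (trans (sym eq) (g-start i e))))
    injective-on-parts (new-leaf l e′) (start i e) eq =
      ⊥-elim (separated (proj₁ (proj₂ (φ-range l e′))) (trans (sym (g-new-leaf l e′)) (trans eq (g-start i e))))
    injective-on-parts (start i e) (old v v∈ e′) eq = ⊥-elim (old≢new v∈ e′ z<x (trans (sym eq) (g-start i e)))
    injective-on-parts (old u u∈ e′) (start i e) eq = ⊥-elim (old≢new u∈ e′ z<x (trans eq (g-start i e)))
    injective-on-parts (new-leaf l e) (old v v∈ e′) eq =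
      ⊥-elim (old≢new v∈ e′ (proj₁ (φ-range l e)) (trans (sym eq) (g-new-leaf l e)))
    injective-on-parts (old u u∈ e′) (new-leaf l e) eq =
      ⊥-elim (old≢new u∈ e′ (proj₁ (φ-range l e)) (trans eq (g-new-leaf l e)))

    after-start : ∀ {i i′ : Fin (2 + Q)} → toℕ i′ ≡ suc (toℕ i) → j ≤ toℕ i → suc j ≤ toℕ i′
    after-start e j≤i = subst (suc j ≤_) (sym e) (s≤s j≤i)

    g-arcs : ∀ u v → InTail j u → InTail j v → TArc T u v → Arc D (g u) (g v)
    g-arcs _ _ j≤i _ (spineF i i′ e dir) with toℕ i ≟ j
    ... | yes i≡j = subst₂ (Arc D) (sym (g-start i i≡j)) (sym (g-next i′ (trans e (cong suc i≡j))))
                      (fits⇒arc j (trans (sym (sdir≡spineDir i i≡j)) dir) fitsxy)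
    ... | no i≢j = subst₂ (Arc D) (sym (g-old-spine i i≢j)) (sym (g-old-spine i′ (>⇒≢ (after-start e j≤i))))
                     (g₀-arcs _ _ (≤∧≢⇒< j≤i (i≢j ∘ sym)) (after-start e j≤i) (spineF i i′ e dir))
    g-arcs _ _ _ j≤i (spineB i i′ e dir) with toℕ i ≟ j
    ... | yes i≡j = subst₂ (Arc D) (sym (g-next i′ (trans e (cong suc i≡j)))) (sym (g-start i i≡j))
                      (fits⇒arc⁻ j (trans (sym (sdir≡spineDir i i≡j)) dir) fitsxy)
    ... | no i≢j = subst₂ (Arc D) (sym (g-old-spine i′ (>⇒≢ (after-start e j≤i)))) (sym (g-old-spine i i≢j))
                     (g₀-arcs _ _ (after-start e j≤i) (≤∧≢⇒< j≤i (i≢j ∘ sym)) (spineB i i′ e dir))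
    g-arcs _ _ _ j<l (leafF l out) with attN l ≟ suc j
    ... | yes e = subst₂ (Arc D) (sym (g-next (att T l) e)) (sym (g-new-leaf l e))
                    (fits⇒arc⁻ j (outLeaf⇒backward l e out) (proj₂ (proj₂ (φ-range l e))))
    ... | no ne = subst₂ (Arc D) (sym (g-old-spine (att T l) (>⇒≢ j<l))) (sym (g-old-leaf l ne))
                    (g₀-arcs _ _ j<l (≤∧≢⇒< j<l (ne ∘ sym)) (leafF l out))
    g-arcs _ _ j<l _ (leafB l in′) with attN l ≟ suc j
    ... | yes e = subst₂ (Arc D) (sym (g-new-leaf l e)) (sym (g-next (att T l) e))
                    (fits⇒arc j (inLeaf⇒forward l e in′) (proj₂ (proj₂ (φ-range l e))))
    ... | no ne = subst₂ (Arc D) (sym (g-old-leaf l ne)) (sym (g-old-spine (att T l) (>⇒≢ j<l)))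
                    (g₀-arcs _ _ (≤∧≢⇒< j<l (ne ∘ sym)) j<l (leafB l in′))

    extended : TailEmbedding (suc r) j x y
    extended = record
      { g = g ; g-start = g-start ; g-next = g-next
      ; g-injective = λ u v u∈ v∈ → injective-on-parts (part u u∈) (part v v∈)
      ; g-arcs = g-arcs
      ; g-allowed = λ v v∈ → offset≤⇒allowed (odd (suc r)) x≢y (≤x (part v v∈)) }

  extendable : ℕ → ℕ → Fin n → Fin n → Bool
  extendable zero j x y = true
  extendable (suc r) j x y = reachable (offset b y x)
    where
      b = odd (suc r)
      open Reachability (candidate b j y) (λ d → extendable r (suc j) y (atOffset b y d)) (length (leavesAt (suc j)))

  module AroundY (r j : ℕ) (y : Fin n) where
    b = odd (suc r)
    σ = offset b y
    N = candidate b j y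
    G : ℕ → Bool
    G d = extendable r (suc j) y (atOffset b y d)
    c = length (leavesAt (suc j))
    open Reachability N G c public

  extend : ∀ r j → suc r + j ≡ Q →
           (∀ y z → fits (suc j) y z ≡ true → extendable r (suc j) y z ≡ true → TailEmbedding r (suc j) y z) →
           ∀ x y → fits j x y ≡ true → extendable (suc r) j x y ≡ true → TailEmbedding (suc r) j x y
  extend r j r+j≡Q embed x y fitsxy ext =
    Extend.extended (embed y z fitsyz Ga) fitsxy z≢y (subst (_< σ x) (sym σz≡a) a<x)
      (subst (λ lo → LeafPlacement j b y lo (σ x)) (sym σz≡a) (placeLeaves j b y a (σ x) (<⇒≤ (offset<n b y x)) room))
    where
      open AroundY r j y
      found = anyBelow-least {σ x} _ ext
      a = proj₁ found
      a<x = proj₁ (proj₂ found)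
      a-good : N a ∧ G a ∧ ⌊ c ≤? countFrom (suc a) (σ x) ⌋ ≡ true
      a-good = proj₁ (proj₂ (proj₂ found))
      Ga : G a ≡ true
      Ga = proj₁ (∧-true (proj₂ (∧-true {N a} a-good)))
      room : c ≤ countFrom (suc a) (σ x)
      room = isYes-sound {d = c ≤? _} (proj₂ (∧-true {G a} (proj₂ (∧-true {N a} a-good))))
      z = atOffset b y a
      σz≡a : σ z ≡ a
      σz≡a = offset-atOffset b y (<-trans a<x (offset<n b y x))
      fitsyz : fits (suc j) y z ≡ true
      fitsyz = trans (fits-suc (<Q r r+j≡Q) z y) (proj₁ (∧-true a-good))
      z≢y : z ≢ y
      z≢y e = fits⇒≢ (suc j) fitsyz (sym e)

  soundness : ∀ r j → r + j ≡ Q → ∀ x y → fits j x y ≡ true → extendable r j x y ≡ true → TailEmbedding r j x y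
  soundness zero j refl x y fitsxy _ = lastEdgeEmbedding x y fitsxy
  soundness (suc r) j r+j≡Q = extend r j r+j≡Q (soundness r (suc j) (trans (+-suc r j) r+j≡Q))

  bad : ℕ → ℕ → ℕ
  bad r j = ∑[ x < n ] ∑[ y < n ] ⟦ fits j x y ∧ not (extendable r j x y) ⟧

  leavesBeyond : ℕ → ℕ
  leavesBeyond j = ∑[ l < L ] ⟦ ⌊ j <? attN l ⌋ ⟧

  leavesBeyond-suc : ∀ j → leavesBeyond j ≡ length (leavesAt (suc j)) + leavesBeyond (suc j)
  leavesBeyond-suc j = begin
    ∑[ l < L ] ⟦ ⌊ j <? attN l ⌋ ⟧
      ≡⟨ sum-cong-≗ {L} (λ l → split (attN l)) ⟩
    ∑[ l < L ] (⟦ ⌊ attN l ≟ suc j ⌋ ⟧ + ⟦ ⌊ suc j <? attN l ⌋ ⟧)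
      ≡⟨ ∑-distrib-+ {L} _ _ ⟩
    ∑[ l < L ] ⟦ ⌊ attN l ≟ suc j ⌋ ⟧ + leavesBeyond (suc j)
      ≡⟨ cong (_+ leavesBeyond (suc j)) (length-filterᵇ-allFin (λ l → ⌊ attN l ≟ suc j ⌋)) ⟨
    length (leavesAt (suc j)) + leavesBeyond (suc j) ∎
    where
      open ≡-Reasoning
      split : ∀ t → ⟦ ⌊ j <? t ⌋ ⟧ ≡ ⟦ ⌊ t ≟ suc j ⌋ ⟧ + ⟦ ⌊ suc j <? t ⌋ ⟧
      split t with j <? t | t ≟ suc j | suc j <? t
      ... | yes _ | yes _ | no _ = refl
      ... | yes _ | no _ | yes _ = refl
      ... | no _ | no _ | no _ = refl
      ... | yes j<t | no t≢1+j | no 1+j≮t = contradiction (≤∧≢⇒< j<t (t≢1+j ∘ sym)) 1+j≮t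
      ... | _ | yes refl | yes 1+j<t = contradiction 1+j<t (<-irrefl refl)
      ... | no j≮t | yes refl | _ = contradiction ≤-refl j≮t
      ... | no j≮t | _ | yes 1+j<t = contradiction (<-trans (n<1+n j) 1+j<t) j≮t

  bad-through : ∀ r j → suc r + j ≡ Q → ∀ y →
    ∑[ x < n ] ⟦ fits j x y ∧ not (extendable (suc r) j x y) ⟧
      ≤ ∑[ z < n ] ⟦ fits (suc j) y z ∧ not (extendable r (suc j) y z) ⟧ + suc (length (leavesAt (suc j)))
  bad-through r j r+j≡Q y = begin
    ∑[ x < n ] ⟦ fits j x y ∧ not (extendable (suc r) j x y) ⟧
      ≡⟨ ∑-by-offset b y (λ x → ⟦ fits j x y ∧ not (extendable (suc r) j x y) ⟧) ⟩
    sumBelow n (λ d → ⟦ N d ∧ not (reachable (σ (atOffset b y d))) ⟧)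
      ≡⟨ sumBelow-cong n (λ d d<n → cong (λ t → ⟦ N d ∧ not (reachable t) ⟧) (offset-atOffset b y d<n)) ⟩
    sumBelow n (λ d → ⟦ N d ∧ not (reachable d) ⟧)
      ≤⟨ count-unreachable n ⟩
    sumBelow n (λ d → ⟦ N d ∧ not (G d) ⟧) + suc c
      ≡⟨ cong (_+ suc c) (sumBelow-cong n (λ d _ → cong (λ t → ⟦ t ∧ not (G d) ⟧) (fits-suc (<Q r r+j≡Q) (atOffset b y d) y))) ⟨
    sumBelow n (λ d → ⟦ fits (suc j) y (atOffset b y d) ∧ not (G d) ⟧) + suc c
      ≡⟨ cong (_+ suc c) (∑-by-offset b y (λ z → ⟦ fits (suc j) y z ∧ not (extendable r (suc j) y z) ⟧)) ⟨
    ∑[ z < n ] ⟦ fits (suc j) y z ∧ not (extendable r (suc j) y z) ⟧ + suc c ∎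
    where
      open ≤-Reasoning
      open AroundY r j y

  bad-bound : ∀ r j → r + j ≡ Q → bad r j ≤ (r + leavesBeyond j) * n
  bad-bound zero j _ = ≤-reflexive′ (∑-zero (λ x → ∑-zero (λ y → cong ⟦_⟧ (∧-zeroʳ (fits j x y)))))
    where
      ≤-reflexive′ : ∀ {a b} → a ≡ 0 → a ≤ b
      ≤-reflexive′ refl = z≤n
  bad-bound (suc r) j r+j≡Q = begin
    bad (suc r) j
      ≡⟨ ∑-comm {n} {n} (λ x y → ⟦ fits j x y ∧ not (extendable (suc r) j x y) ⟧) ⟩
    ∑[ y < n ] ∑[ x < n ] ⟦ fits j x y ∧ not (extendable (suc r) j x y) ⟧
      ≤⟨ ∑-mono-≤ (bad-through r j r+j≡Q) ⟩
    ∑[ y < n ] (∑[ z < n ] ⟦ fits (suc j) y z ∧ not (extendable r (suc j) y z) ⟧ + suc c)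
      ≡⟨ ∑-distrib-+ {n} (λ y → ∑[ z < n ] ⟦ fits (suc j) y z ∧ not (extendable r (suc j) y z) ⟧) (λ _ → suc c) ⟩
    bad r (suc j) + ∑[ y < n ] suc c
      ≡⟨ cong (bad r (suc j) +_) (∑-const n (suc c)) ⟩
    bad r (suc j) + n * suc c
      ≤⟨ +-monoˡ-≤ (n * suc c) (bad-bound r (suc j) (trans (+-suc r j) r+j≡Q)) ⟩
    (r + leavesBeyond (suc j)) * n + n * suc c
      ≡⟨ rearrange r (leavesBeyond (suc j)) c n ⟩
    (suc r + (c + leavesBeyond (suc j))) * n
      ≡⟨ cong (λ t → (suc r + t) * n) (leavesBeyond-suc j) ⟨
    (suc r + leavesBeyond j) * n ∎
    where
      open ≤-Reasoning
      c = length (leavesAt (suc j))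
      rearrange : ∀ r k c n → (r + k) * n + n * suc c ≡ (suc r + (c + k)) * n
      rearrange = solve-∀

  InTail-0 : ∀ v → InTail 0 v
  InTail-0 (inj₁ i) = z≤n
  InTail-0 (inj₂ l) = proj₁ (inner T l)

  module Full {x y : Fin n} (e : TailEmbedding Q 0 x y) where
    open TailEmbedding e

    embedding : Embedding T D
    embedding = record
      { f = g
      ; inj = λ {u} {v} → g-injective u v (InTail-0 u) (InTail-0 v)
      ; arcs = λ u v → g-arcs u v (InTail-0 u) (InTail-0 v) }

    g-u : g (finalU T) ≡ x
    g-u = g-start fzero refl

    g-v : g (finalV T) ≡ y
    g-v = g-next (fsuc fzero) refl

    avoids-inner : spineSize T % 2 ≡ 1 → ∀ w → ¬ Between (g (finalU T)) (g (finalV T)) (g w)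
    avoids-inner h w rewrite g-u | g-v = subst (λ b → Allowed b x y (g w)) (odd-%2≡1 Q h) (g-allowed w (InTail-0 w))

    avoids-outer : spineSize T % 2 ≡ 0 → ∀ w → ¬ Outside (g (finalU T)) (g (finalV T)) (g w)
    avoids-outer h w rewrite g-u | g-v = subst (λ b → Allowed b x y (g w)) (odd-%2≡0 Q h) (g-allowed w (InTail-0 w))

  orientArc : Fin n × Fin n → Fin n × Fin n
  orientArc (x , y) = if spineDir 0 then (x , y) else (y , x)

  orientArc-injective : ∀ {p p′} → orientArc p ≡ orientArc p′ → p ≡ p′
  orientArc-injective e with spineDir 0
  ... | true = e
  ... | false = cong swap e

  orientArc-good : ∀ {x y} → fits 0 x y ≡ true → TailEmbedding Q 0 x y → Good T D (orientArc (x , y))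
  orientArc-good fitsxy e with spineDir 0 in dir
  ... | true = fitsxy , embedding , inj₁ (spineF fzero (fsuc fzero) refl (trans (sdir≡spineDir fzero refl) dir) , g-u , g-v)
             , avoids-inner , avoids-outer
    where open Full e
  ... | false = fitsxy , embedding , inj₂ (spineB fzero (fsuc fzero) refl (trans (sdir≡spineDir fzero refl) dir) , g-v , g-u)
              , avoids-inner , avoids-outer
    where open Full e

  isGoodPair : Fin n × Fin n → Bool
  isGoodPair (x , y) = fits 0 x y ∧ extendable Q 0 x y

  goodPairs : List (Fin n × Fin n)
  goodPairs = filterᵇ isGoodPair (cartesianProduct (allFin n) (allFin n))

  goodArcs : List (Fin n × Fin n)
  goodArcs = map orientArc goodPairs

  goodArcs-unique : Unique goodArcs
  goodArcs-unique = Unique.map⁺ orientArc-injective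
    (Unique.filter⁺ (T? ∘ isGoodPair) (Unique.cartesianProduct⁺ (Unique.allFin⁺ n) (Unique.allFin⁺ n)))

  goodArcs-good : All (Good T D) goodArcs
  goodArcs-good = All-map⁺ (All.map (λ {p} → good p ∘ Equivalence.to T-≡) (all-filter (T? ∘ isGoodPair) _))
    where
      good : ∀ p → isGoodPair p ≡ true → Good T D (orientArc p)
      good (x , y) xy-good = orientArc-good fitsxy (soundness Q 0 (+-identityʳ Q) x y fitsxy (proj₂ (∧-true xy-good)))
        where fitsxy = proj₁ (∧-true xy-good)

  numArcs≡∑fits : numArcs D ≡ ∑[ x < n ] ∑[ y < n ] ⟦ fits 0 x y ⟧
  numArcs≡∑fits = trans (listSum-allFin² (λ s t → ⟦ adj D s t ⟧)) reorient
    where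
      reorient : ∑[ s < n ] ∑[ t < n ] ⟦ adj D s t ⟧ ≡ ∑[ x < n ] ∑[ y < n ] ⟦ fits 0 x y ⟧
      reorient with spineDir 0
      ... | true = refl
      ... | false = ∑-comm {n} {n} (λ s t → ⟦ adj D s t ⟧)

  leavesBeyond-0 : leavesBeyond 0 ≡ L
  leavesBeyond-0 = trans (sum-cong-≗ {L} attached) (trans (∑-const L 1) (*-identityʳ L))
    where
      attached : ∀ l → ⟦ ⌊ 0 <? attN l ⌋ ⟧ ≡ 1
      attached l = cong ⟦_⟧ (isYes-complete (0 <? attN l) (proj₁ (inner T l)))

  numArcs-bound : numArcs D ≤ (Q + L) * n + length goodArcs
  numArcs-bound = begin
    numArcs D
      ≡⟨ numArcs≡∑fits ⟩
    ∑[ x < n ] ∑[ y < n ] ⟦ fits 0 x y ⟧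
      ≡⟨ ∑∑-split (fits 0) (extendable Q 0) ⟩
    ∑[ x < n ] ∑[ y < n ] ⟦ isGoodPair (x , y) ⟧ + bad Q 0
      ≤⟨ +-monoʳ-≤ _ (bad-bound Q 0 (+-identityʳ Q)) ⟩
    ∑[ x < n ] ∑[ y < n ] ⟦ isGoodPair (x , y) ⟧ + (Q + leavesBeyond 0) * n
      ≡⟨ cong₂ (λ a k → a + (Q + k) * n) (sym length-goodArcs) leavesBeyond-0 ⟩
    length goodArcs + (Q + L) * n
      ≡⟨ +-comm (length goodArcs) _ ⟩
    (Q + L) * n + length goodArcs ∎
    where
      open ≤-Reasoning
      length-goodArcs : length goodArcs ≡ ∑[ x < n ] ∑[ y < n ] ⟦ isGoodPair (x , y) ⟧
      length-goodArcs = trans (length-map orientArc goodPairs) (length-filterᵇ-allFin² isGoodPair)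

lemma4p1 : (k n : ℕ) → 0 < k → 0 < n →
    (T : OrientedCaterpillar) → Antidirected T → numTArcs T ≡ k →
    (D : ConvexDigraph n) →
    Σ (List (Fin n × Fin n)) λ G →
    Unique G × All (Good T D) G × numArcs D ∸ (k ∸ 1) * n ≤ length G
lemma4p1 k zero _ () T antidirected _ D
lemma4p1 .(numTArcs T) (suc m) _ _ T antidirected refl D =
  goodArcs , goodArcs-unique , goodArcs-good , m≤n+o⇒m∸n≤o (numArcs D) ((Q + L) * suc m) numArcs-bound
  where open Construction m D T antidirected
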